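{- Let $T$ be a lattice upward triangle of $T_n$. Then every unit rhombus and every type-1 trapezoid $S$ of $T_n$ satisfies: the number of unit upward triangles of $T_n$ contained in $S \cap T$ is at least the number of unit downward triangles of $T_n$ contained in $S \cap T$.
   Context: $T_n$ is a closed equilateral triangle of side length $n$ with horizontal base and apex up, subdivided by lines parallel to its sides at integer distances into unit equilateral triangles (upward-pointing: unit upward triangles; downward-pointing: unit downward triangles). A lattice upward triangle is a translate of some $T_k$, $k\le n$, contained in $T_n$ and equal to a union of unit triangles. A unit rhombus is the union of two unit triangles of $T_n$ sharing an edge. A type-1 trapezoid is a lattice trapezoid in $T_n$ that is the union of two unit upward triangles and one unit downward triangle. -}

module Defs where

open import Data.Nat using (ℕ; suc; _+_; _≤_; _≤?_)
open import Data.Product using (_×_; _,_)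
open import Data.Fin using (Fin; zero; suc)
open import Data.List using (List; []; _∷_; length; filter)
open import Relation.Binary.PropositionalEquality using (_≡_)
open import Relation.Nullary using (Dec; ¬_)
open import Relation.Nullary.Decidable using (_×-dec_)

-- Barycentric ("distance to the three sides") coordinates in T_n.
-- A unit triangle is a triple (a , b , c) of naturals.
--  * unit upward triangle (a,b,c):   a + b + c + 1 ≡ n
--      (region x ≥ a, y ≥ b, z ≥ c in coordinates x + y + z = n)
--  * unit downward triangle (a,b,c): a + b + c + 2 ≡ n
--      (region x ≤ a+1, y ≤ b+1, z ≤ c+1)
Tri : Set
Tri = ℕ × ℕ × ℕ

IsUp : ℕ → Tri → Set
IsUp n (a , b , c) = a + b + c + 1 ≡ n

IsDown : ℕ → Tri → Set
IsDown n (a , b , c) = a + b + c + 2 ≡ n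

-- A lattice upward triangle of T_n: translate of T_k (1 ≤ k ≤ n) given by
-- its corner coordinates (a,b,c) with a + b + c + k ≡ n; its region is
-- x ≥ a, y ≥ b, z ≥ c.
record LatticeUp (n : ℕ) : Set where
  constructor latticeUp
  field
    a b c k : ℕ
    1≤k     : 1 ≤ k
    sumEq   : a + b + c + k ≡ n

-- A unit triangle (upward or downward) with coordinates (a',b',c') is
-- contained in the lattice upward triangle T iff a ≤ a', b ≤ b', c ≤ c'.
InLU : ∀ {n} → LatticeUp n → Tri → Set
InLU T (a' , b' , c') = LatticeUp.a T ≤ a' × LatticeUp.b T ≤ b' × LatticeUp.c T ≤ c'

inLU? : ∀ {n} (T : LatticeUp n) (t : Tri) → Dec (InLU T t)
inLU? T (a' , b' , c') =
  (LatticeUp.a T ≤? a') ×-dec ((LatticeUp.b T ≤? b') ×-dec (LatticeUp.c T ≤? c'))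

-- The unit upward triangle sharing the i-th edge of the downward triangle d.
nbr : Tri → Fin 3 → Tri
nbr (a , b , c) zero = (suc a , b , c)
nbr (a , b , c) (suc zero) = (a , suc b , c)
nbr (a , b , c) (suc (suc zero)) = (a , b , suc c)

record Shape : Set where
  constructor shape
  field
    ups   : List Tri
    downs : List Tri

-- Unit rhombi of T_n: union of a unit downward triangle d and one of its
-- three edge-neighbouring unit upward triangles (two unit triangles sharing
-- an edge are always one upward and one downward).
data IsRhombus (n : ℕ) : Shape → Set where
  rhombus : (d : Tri) → IsDown n d → (i : Fin 3) →
            IsRhombus n (shape (nbr d i ∷ []) (d ∷ []))

-- Type-1 trapezoids of T_n: a unit downward triangle d together with two
-- distinct edge-neighbouring unit upward triangles.
data IsTrapezoid1 (n : ℕ) : Shape → Set where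
  trapezoid : (d : Tri) → IsDown n d → (i j : Fin 3) → ¬ (i ≡ j) →
              IsTrapezoid1 n (shape (nbr d i ∷ nbr d j ∷ []) (d ∷ []))

#upIn : ∀ {n} → Shape → LatticeUp n → ℕ
#upIn S T = length (filter (inLU? T) (Shape.ups S))

#downIn : ∀ {n} → Shape → LatticeUp n → ℕ
#downIn S T = length (filter (inLU? T) (Shape.downs S))

module Submission where

open import Defs
open import Data.Nat using (ℕ; _≤_; z≤n; s≤s)
open import Data.Nat.Properties using (m≤n⇒m≤1+n)
open import Data.List using (List; []; _∷_; [_]; length; filter)
open import Data.List.Properties using (filter-accept)
open import Data.Sum using (_⊎_; inj₁; inj₂)
open import Data.Product using (_,_)
open import Data.Fin using (Fin; zero; suc)
open import Relation.Unary using (Pred; Decidable)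
open import Relation.Nullary using (yes; no)

-- Each shape has a single downward triangle d, and T is closed under passing
-- from d to its upward neighbours, so the only downward triangle that can be
-- counted is matched by an upward one.

InLU-nbr : ∀ {n} (T : LatticeUp n) (d : Tri) (i : Fin 3) → InLU T d → InLU T (nbr d i)
InLU-nbr T d zero             (p , q , r) = m≤n⇒m≤1+n p , q , r
InLU-nbr T d (suc zero)       (p , q , r) = p , m≤n⇒m≤1+n q , r
InLU-nbr T d (suc (suc zero)) (p , q , r) = p , q , m≤n⇒m≤1+n r

length-filter-[x]≤ : ∀ {a p} {A : Set a} {P : Pred A p} (P? : Decidable P)
  {x y : A} (ys : List A) → (P x → P y) →
  length (filter P? [ x ]) ≤ length (filter P? (y ∷ ys))
length-filter-[x]≤ P? {x} {y} ys Px⇒Py with P? x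
... | no _    = z≤n
... | yes Px rewrite filter-accept P? {y} {ys} (Px⇒Py Px) = s≤s z≤n

#down≤#up-nbr : ∀ {n} (T : LatticeUp n) (d : Tri) (i : Fin 3) (us : List Tri) →
  #downIn (shape (nbr d i ∷ us) [ d ]) T ≤ #upIn (shape (nbr d i ∷ us) [ d ]) T
#down≤#up-nbr T d i us = length-filter-[x]≤ (inLU? T) us (InLU-nbr T d i)

lemma5p7 : (n : ℕ) (T : LatticeUp n) (S : Shape) →
    IsRhombus n S ⊎ IsTrapezoid1 n S →
    #downIn S T ≤ #upIn S T
lemma5p7 n T _ (inj₁ (rhombus d _ i))       = #down≤#up-nbr T d i []
lemma5p7 n T _ (inj₂ (trapezoid d _ i j _)) = #down≤#up-nbr T d i [ nbr d j ]
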